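{- Let $G$ be a directed acyclic graph on $n \ge 2$ vertices with source $s$ and destination $t$ such that: every vertex and every edge of $G$ lies on some directed $s$-$t$ path; $\deg(s)\ge 2$ and $\deg(t)\ge 2$; and there are no vertices $x,y,z$ with $(x,y),(y,z)\in E(G)$ and $\deg(x)=\deg(y)=2$. Then $G$ has at least $n/5$ directed $s$-$t$ paths.
   Context: $\deg(v)$ denotes the total degree (in-degree plus out-degree) of $v$. The three conditions express that $G$ is reduced with respect to the paper's preprocessing rules (removing vertices/edges not on any $s$-$t$ path, replacing a degree-one source or destination by its unique neighbor, and short-circuiting a degree-two vertex following another degree-two vertex). -}

module Defs where

open import Data.Nat using (ℕ; zero; suc; _+_)
open import Data.Bool using (Bool; true; false; if_then_else_)
open import Data.Fin using (Fin)
open import Data.List using (List; map; allFin)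
open import Data.Nat.ListAction using (sum)
open import Data.Product using (Σ; _×_; ∃)
open import Relation.Binary.PropositionalEquality using (_≡_)
open import Relation.Nullary using (¬_)
open import Data.Empty using (⊥)

Digraph : ℕ → Set
Digraph n = Fin n → Fin n → Bool

Edge : ∀ {n} → Digraph n → Fin n → Fin n → Set
Edge E u v = E u v ≡ true

-- Directed walks from x to y (in a DAG these are exactly the directed paths).
data Walk {n : ℕ} (E : Digraph n) : Fin n → Fin n → Set where
  [] : ∀ {x} → Walk E x x
  _∷_ : ∀ {x y z} → Edge E x y → Walk E y z → Walk E x z

Acyclic : ∀ {n} → Digraph n → Set
Acyclic {n} E = ∀ (u v : Fin n) → Edge E u v → ¬ Walk E v u

indicator : Bool → ℕ
indicator b = if b then 1 else 0

outDeg : ∀ {n} → Digraph n → Fin n → ℕ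
outDeg {n} E v = sum (map (λ u → indicator (E v u)) (allFin n))

inDeg : ∀ {n} → Digraph n → Fin n → ℕ
inDeg {n} E v = sum (map (λ u → indicator (E u v)) (allFin n))

deg : ∀ {n} → Digraph n → Fin n → ℕ
deg E v = inDeg E v + outDeg E v

VerticesOnSTPaths : ∀ {n} → Digraph n → Fin n → Fin n → Set
VerticesOnSTPaths {n} E s t = ∀ (v : Fin n) → Walk E s v × Walk E v t

EdgesOnSTPaths : ∀ {n} → Digraph n → Fin n → Fin n → Set
EdgesOnSTPaths {n} E s t =
  ∀ (u v : Fin n) → Edge E u v → Walk E s u × Walk E v t

NoConsecutiveDeg2 : ∀ {n} → Digraph n → Set
NoConsecutiveDeg2 {n} E =
  ∀ (x y z : Fin n) → Edge E x y → Edge E y z → deg E x ≡ 2 → deg E y ≡ 2 → ⊥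

-- Fix for every v ≠ t an out-edge v → next v; following these edges from any vertex gives a
-- canonical path to t, since G is acyclic. Every other edge (u , w) yields the s-t path
-- s ⇝ u → w followed by the canonical path of w, and (u , w) can be read back off it as its
-- last non-canonical edge. Together with the canonical path of s this gives m - n + 2
-- distinct s-t paths, m being the number of edges.
-- The degree-2 vertices other than t form an independent set D, since no two degree-2
-- vertices are consecutive; hence 2|D| ≤ m. All vertices outside D ∪ {s, t} have degree at
-- least 3, so 2m ≥ 3n - |D| - 2, and together 5m ≥ 6n - 4, i.e. 5(m - n + 2) ≥ n + 6.
module Submission where

open import Defs
open import Data.Nat as ℕ using (ℕ; zero; suc; _+_; _*_; _≤_; _<_; _≥_; z≤n; s≤s)
open import Data.Nat.Properties hiding (_≟_)
open import Data.Nat.Tactic.RingSolver using (solve-∀)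
open import Data.Fin using (Fin; zero; suc; toℕ)
open import Data.Fin.Properties using (_≟_; pigeonhole; toℕ<n)
import Data.Bool.Properties as Bool
open import Data.Bool using (true; false; _∧_; not; if_then_else_)
open import Data.List using (List; []; _∷_; _++_; map; allFin; tabulate; cartesianProduct; filter; length)
open import Data.List.Properties using (map-tabulate; map-++; map-∘; map-id-local; length-map)
open import Data.List.Relation.Unary.All as All using (All; []; _∷_)
import Data.List.Relation.Unary.All.Properties as All
open import Data.List.Relation.Unary.AllPairs using (_∷_)
open import Data.List.Relation.Unary.Unique.Propositional using (Unique)
import Data.List.Relation.Unary.Unique.Propositional.Properties as Unique
open import Data.Maybe using (Maybe; just; nothing; _<∣>_)
open import Data.Maybe.Properties using (just-injective)
open import Data.Nat.ListAction using (sum)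
open import Data.Nat.ListAction.Properties using (sum-++)
open import Data.Product using (Σ; _×_; _,_; proj₁; proj₂; ∃)
open import Data.Unit using (⊤; tt)
open import Data.Empty using (⊥)
open import Function using (_∘_; id)
open import Relation.Binary.PropositionalEquality
open import Relation.Nullary using (Dec; does; yes; no; contradiction; ¬?; _×-dec_)
open import Relation.Nullary.Decidable using (dec-true; dec-false)
open import Relation.Unary using (Pred; Decidable)
open import Algebra.Properties.CommutativeMonoid.Sum +-0-commutativeMonoid
  using (sum-syntax; sum-cong-≗; sum-replicate-zero; ∑-comm; ∑-distrib-+)
  renaming (sum to ∑)
open import Algebra.Properties.Semiring.Sum +-*-semiring using (*-distribˡ-sum)

𝟙 : ∀ {a} {A : Set a} → Dec A → ℕ
𝟙 a? = indicator (does a?)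

sum-tabulate : ∀ {n} (f : Fin n → ℕ) → sum (tabulate f) ≡ ∑[ i < n ] f i
sum-tabulate {zero} f = refl
sum-tabulate {suc n} f = cong (f zero +_) (sum-tabulate (f ∘ suc))

sum-map-allFin : ∀ {n} (f : Fin n → ℕ) → sum (map f (allFin n)) ≡ ∑[ i < n ] f i
sum-map-allFin f = trans (cong sum (map-tabulate id f)) (sum-tabulate f)

sum-map-cartesianProduct : ∀ {a b} {A : Set a} {B : Set b} (f : A × B → ℕ) xs ys →
  sum (map f (cartesianProduct xs ys)) ≡ sum (map (λ x → sum (map (λ y → f (x , y)) ys)) xs)
sum-map-cartesianProduct f [] ys = refl
sum-map-cartesianProduct f (x ∷ xs) ys = begin
  sum (map f (map (x ,_) ys ++ cartesianProduct xs ys))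
    ≡⟨ cong sum (map-++ f (map (x ,_) ys) _) ⟩
  sum (map f (map (x ,_) ys) ++ map f (cartesianProduct xs ys))
    ≡⟨ sum-++ (map f (map (x ,_) ys)) _ ⟩
  sum (map f (map (x ,_) ys)) + sum (map f (cartesianProduct xs ys))
    ≡⟨ cong₂ _+_ (cong sum (sym (map-∘ ys))) (sum-map-cartesianProduct f xs ys) ⟩
  sum (map (λ y → f (x , y)) ys) + sum (map (λ x → sum (map (λ y → f (x , y)) ys)) xs) ∎
  where open ≡-Reasoning

length-filter : ∀ {a p} {A : Set a} {P : Pred A p} (P? : Decidable P) xs →
  length (filter P? xs) ≡ sum (map (𝟙 ∘ P?) xs)
length-filter P? [] = refl
length-filter P? (x ∷ xs) with does (P? x)
... | true = cong suc (length-filter P? xs)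
... | false = length-filter P? xs

∑-mono-≤ : ∀ {n} {f g : Fin n → ℕ} → (∀ i → f i ≤ g i) → ∑[ i < n ] f i ≤ ∑[ i < n ] g i
∑-mono-≤ {zero} f≤g = z≤n
∑-mono-≤ {suc n} f≤g = +-mono-≤ (f≤g zero) (∑-mono-≤ (f≤g ∘ suc))

∑-const : ∀ n c → ∑[ i < n ] c ≡ n * c
∑-const zero c = refl
∑-const (suc n) c = cong (c +_) (∑-const n c)

∑-δ : ∀ {n} (c : Fin n) (f : Fin n → ℕ) → ∑[ i < n ] (𝟙 (i ≟ c) * f i) ≡ f c
∑-δ {suc n} zero f = trans (cong₂ _+_ (+-identityʳ (f zero)) (sum-replicate-zero n)) (+-identityʳ (f zero))
∑-δ {suc n} (suc c) f = ∑-δ c (f ∘ suc)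

∑-𝟙≢ : ∀ {n} (c : Fin n) → ∑[ i < n ] 𝟙 (¬? (i ≟ c)) + 1 ≡ n
∑-𝟙≢ {n} c = begin
  ∑[ i < n ] 𝟙 (¬? (i ≟ c)) + 1
    ≡⟨ cong (∑[ i < n ] 𝟙 (¬? (i ≟ c)) +_) (∑-δ c (λ _ → 1)) ⟨
  ∑[ i < n ] 𝟙 (¬? (i ≟ c)) + ∑[ i < n ] (𝟙 (i ≟ c) * 1)
    ≡⟨ ∑-distrib-+ (λ i → 𝟙 (¬? (i ≟ c))) (λ i → 𝟙 (i ≟ c) * 1) ⟨
  ∑[ i < n ] (𝟙 (¬? (i ≟ c)) + 𝟙 (i ≟ c) * 1)
    ≡⟨ sum-cong-≗ (λ i → complement (does (i ≟ c))) ⟩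
  ∑[ i < n ] 1
    ≡⟨ ∑-const n 1 ⟩
  n * 1
    ≡⟨ *-identityʳ n ⟩
  n ∎
  where
  open ≡-Reasoning
  complement : ∀ b → indicator (not b) + indicator b * 1 ≡ 1
  complement true = refl
  complement false = refl

indicator≤1 : ∀ b → indicator b ≤ 1
indicator≤1 true = ≤-refl
indicator≤1 false = z≤n

≤-∑ : ∀ {n} (c : Fin n) (f : Fin n → ℕ) → f c ≤ ∑[ i < n ] f i
≤-∑ c f = begin
  f c                          ≡⟨ ∑-δ c f ⟨
  ∑[ i < _ ] (𝟙 (i ≟ c) * f i)  ≤⟨ ∑-mono-≤ (λ i → *-monoˡ-≤ (f i) (indicator≤1 (does (i ≟ c)))) ⟩
  ∑[ i < _ ] (1 * f i)          ≡⟨ sum-cong-≗ (λ i → *-identityˡ (f i)) ⟩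
  ∑[ i < _ ] f i                ∎
  where open ≤-Reasoning

module _ {n} (E : Digraph n) where

  edgeCount : ℕ
  edgeCount = ∑[ u < n ] outDeg E u

  outDeg-∑ : ∀ u → outDeg E u ≡ ∑[ w < n ] indicator (E u w)
  outDeg-∑ u = sum-map-allFin (indicator ∘ E u)

  inDeg-∑ : ∀ w → inDeg E w ≡ ∑[ u < n ] indicator (E u w)
  inDeg-∑ w = sum-map-allFin (λ u → indicator (E u w))

  edge⇒outDeg≥1 : ∀ {u w} → Edge E u w → outDeg E u ≥ 1
  edge⇒outDeg≥1 {u} {w} e = begin
    1                              ≡⟨ cong indicator e ⟨
    indicator (E u w)              ≤⟨ ≤-∑ w (indicator ∘ E u) ⟩
    ∑[ w < n ] indicator (E u w)   ≡⟨ outDeg-∑ u ⟨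
    outDeg E u                     ∎
    where open ≤-Reasoning

  edge⇒inDeg≥1 : ∀ {u w} → Edge E u w → inDeg E w ≥ 1
  edge⇒inDeg≥1 {u} {w} e = begin
    1                              ≡⟨ cong indicator e ⟨
    indicator (E u w)              ≤⟨ ≤-∑ u (λ u → indicator (E u w)) ⟩
    ∑[ u < n ] indicator (E u w)   ≡⟨ inDeg-∑ w ⟨
    inDeg E w                      ∎
    where open ≤-Reasoning

  outDeg≡0⇒¬edge : ∀ {u} → outDeg E u ≡ 0 → ∀ w → E u w ≡ false
  outDeg≡0⇒¬edge {u} out0 w with E u w in e
  ... | true = contradiction (subst (1 ≤_) out0 (edge⇒outDeg≥1 e)) λ ()
  ... | false = refl

  ∑-deg : ∑[ v < n ] deg E v ≡ edgeCount + edgeCount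
  ∑-deg = begin
    ∑[ v < n ] (inDeg E v + outDeg E v)           ≡⟨ ∑-distrib-+ (inDeg E) (outDeg E) ⟩
    ∑[ v < n ] inDeg E v + edgeCount              ≡⟨ cong (_+ edgeCount) ∑-inDeg ⟩
    edgeCount + edgeCount                         ∎
    where
    open ≡-Reasoning
    ∑-inDeg : ∑[ w < n ] inDeg E w ≡ edgeCount
    ∑-inDeg = begin
      ∑[ w < n ] inDeg E w                         ≡⟨ sum-cong-≗ inDeg-∑ ⟩
      ∑[ w < n ] ∑[ u < n ] indicator (E u w)      ≡⟨ ∑-comm (λ w u → indicator (E u w)) ⟩
      ∑[ u < n ] ∑[ w < n ] indicator (E u w)      ≡⟨ sum-cong-≗ outDeg-∑ ⟨
      edgeCount                                    ∎

  -- Each edge has at most one endpoint in an independent set, so it is counted at most once.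
  independent-∑-deg≤edgeCount : ∀ {p} {P : Pred (Fin n) p} (P? : Decidable P) →
    (∀ u w → Edge E u w → P u → P w → ⊥) →
    ∑[ v < n ] (𝟙 (P? v) * deg E v) ≤ edgeCount
  independent-∑-deg≤edgeCount P? independent = begin
    ∑[ v < n ] (𝟙 (P? v) * (inDeg E v + outDeg E v))
      ≡⟨ sum-cong-≗ (λ v → *-distribˡ-+ (𝟙 (P? v)) (inDeg E v) (outDeg E v)) ⟩
    ∑[ v < n ] (𝟙 (P? v) * inDeg E v + 𝟙 (P? v) * outDeg E v)
      ≡⟨ ∑-distrib-+ (λ v → 𝟙 (P? v) * inDeg E v) (λ v → 𝟙 (P? v) * outDeg E v) ⟩
    ∑[ w < n ] (𝟙 (P? w) * inDeg E w) + ∑[ u < n ] (𝟙 (P? u) * outDeg E u)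
      ≡⟨ cong₂ _+_ heads tails ⟩
    ∑[ u < n ] ∑[ w < n ] head u w + ∑[ u < n ] ∑[ w < n ] tail u w
      ≡⟨ ∑-distrib-+ (λ u → ∑[ w < n ] head u w) (λ u → ∑[ w < n ] tail u w) ⟨
    ∑[ u < n ] (∑[ w < n ] head u w + ∑[ w < n ] tail u w)
      ≡⟨ sum-cong-≗ (λ u → ∑-distrib-+ (head u) (tail u)) ⟨
    ∑[ u < n ] ∑[ w < n ] (head u w + tail u w)
      ≤⟨ ∑-mono-≤ (λ u → ∑-mono-≤ (at-most-once u)) ⟩
    ∑[ u < n ] ∑[ w < n ] indicator (E u w)
      ≡⟨ sum-cong-≗ outDeg-∑ ⟨
    edgeCount ∎
    where
    open ≤-Reasoning
    head tail : Fin n → Fin n → ℕ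
    head u w = 𝟙 (P? w) * indicator (E u w)
    tail u w = 𝟙 (P? u) * indicator (E u w)
    heads : ∑[ w < n ] (𝟙 (P? w) * inDeg E w) ≡ ∑[ u < n ] ∑[ w < n ] head u w
    heads = trans (sum-cong-≗ (λ w → trans (cong (𝟙 (P? w) *_) (inDeg-∑ w)) (*-distribˡ-sum (𝟙 (P? w)) (λ u → indicator (E u w)))))
                  (∑-comm (λ w u → head u w))
    tails : ∑[ u < n ] (𝟙 (P? u) * outDeg E u) ≡ ∑[ u < n ] ∑[ w < n ] tail u w
    tails = sum-cong-≗ (λ u → trans (cong (𝟙 (P? u) *_) (outDeg-∑ u)) (*-distribˡ-sum (𝟙 (P? u)) (indicator ∘ E u)))
    at-most-once : ∀ u w → head u w + tail u w ≤ indicator (E u w)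
    at-most-once u w with E u w in e | P? u | P? w
    ... | false | pu? | pw? = ≤-reflexive (cong₂ _+_ (*-zeroʳ (𝟙 pw?)) (*-zeroʳ (𝟙 pu?)))
    ... | true | yes pu | yes pw = contradiction pw (independent u w e pu)
    ... | true | yes _ | no _ = ≤-refl
    ... | true | no _ | yes _ = ≤-refl
    ... | true | no _ | no _ = z≤n

module _ {n} {E : Digraph n} where

  infixr 5 _++ᵂ_

  _++ᵂ_ : ∀ {x y z} → Walk E x y → Walk E y z → Walk E x z
  [] ++ᵂ q = q
  (e ∷ p) ++ᵂ q = e ∷ (p ++ᵂ q)

  walkLength : ∀ {x y} → Walk E x y → ℕ
  walkLength [] = 0
  walkLength (_ ∷ p) = suc (walkLength p)

  -- Positions past the end of the walk all give its last vertex.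
  vertexAt : ∀ {x y} → Walk E x y → ℕ → Fin n
  vertexAt {x} [] _ = x
  vertexAt {x} (_ ∷ p) zero = x
  vertexAt (_ ∷ p) (suc k) = vertexAt p k

  prefix : ∀ {x y} (p : Walk E x y) k → Walk E x (vertexAt p k)
  prefix [] k = []
  prefix (e ∷ p) zero = []
  prefix (e ∷ p) (suc k) = e ∷ prefix p k

  acyclic-vertexAt-injective : Acyclic E → ∀ {x y} (p : Walk E x y) {i j} →
    i < j → j ≤ walkLength p → vertexAt p i ≢ vertexAt p j
  acyclic-vertexAt-injective acyclic (_∷_ {x} {y} e p) {zero} {suc j} _ _ x≡pⱼ =
    acyclic x y e (subst (Walk E y) (sym x≡pⱼ) (prefix p j))
  acyclic-vertexAt-injective acyclic (e ∷ p) {suc i} {suc j} (s≤s i<j) (s≤s j≤∣p∣) =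
    acyclic-vertexAt-injective acyclic p i<j j≤∣p∣

  acyclic⇒walkLength<n : Acyclic E → ∀ {x y} (p : Walk E x y) → walkLength p < n
  acyclic⇒walkLength<n acyclic p with n ℕ.≤? walkLength p
  ... | no n≰∣p∣ = ≰⇒> n≰∣p∣
  ... | yes n≤∣p∣ with i , j , i<j , pᵢ≡pⱼ ← pigeonhole (s≤s n≤∣p∣) (vertexAt p ∘ toℕ) =
    contradiction pᵢ≡pⱼ (acyclic-vertexAt-injective acyclic p i<j (≤-pred (toℕ<n j)))

  -- The successor of an empty walk is its only vertex.
  successor : ∀ {x y} → Walk E x y → Fin n
  successor {x} [] = x
  successor (_∷_ {y = y} _ _) = y

  successor-edge : ∀ {x y} (p : Walk E x y) → x ≢ y → Edge E x (successor p)
  successor-edge [] x≢x = contradiction refl x≢x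
  successor-edge (e ∷ _) _ = e

  lastEdge : ∀ {x y} → Walk E x y → x ≢ y → ∃ λ w → Edge E w y
  lastEdge [] x≢x = contradiction refl x≢x
  lastEdge (e ∷ p) _ = lastEdge-∷ e p
    where
    lastEdge-∷ : ∀ {u v z} → Edge E u v → Walk E v z → ∃ λ w → Edge E w z
    lastEdge-∷ e [] = _ , e
    lastEdge-∷ _ (e ∷ p) = lastEdge-∷ e p

unique-map-leftInverse : ∀ {a b} {A : Set a} {B : Set b} {xs : List A} (f : A → B) (g : B → A) →
  All (λ x → g (f x) ≡ x) xs → Unique xs → Unique (map f xs)
unique-map-leftInverse {xs = xs} f g g∘f≡id unique =
  Unique.map⁻ (subst Unique (sym (trans (sym (map-∘ {g = g} {f = f} xs)) (map-id-local g∘f≡id))) unique)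

module Detours {n} (E : Digraph n) (acyclic : Acyclic E) (s t : Fin n)
  (onPath : VerticesOnSTPaths E s t) (outDeg-t : outDeg E t ≡ 0) where

  next : Fin n → Fin n
  next v = successor (proj₂ (onPath v))

  next-edge : ∀ v → v ≢ t → Edge E v (next v)
  next-edge v = successor-edge (proj₂ (onPath v))

  Canonical : ∀ {x y} → Walk E x y → Set
  Canonical [] = ⊤
  Canonical (_∷_ {x} {y} _ p) = y ≡ next x × Canonical p

  canonicalWithin : ∀ k v → (∀ {y} (p : Walk E v y) → walkLength p < k) → Σ (Walk E v t) Canonical
  canonicalWithin zero v bounded = contradiction (bounded []) λ ()
  canonicalWithin (suc k) v bounded with v ≟ t
  ... | yes refl = [] , tt
  ... | no v≢t with p , canonical-p ← canonicalWithin k (next v) (≤-pred ∘ bounded ∘ (next-edge v v≢t ∷_)) =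
    next-edge v v≢t ∷ p , refl , canonical-p

  canonical : ∀ v → Walk E v t
  canonical v = proj₁ (canonicalWithin n v (acyclic⇒walkLength<n acyclic))

  canonical-isCanonical : ∀ v → Canonical (canonical v)
  canonical-isCanonical v = proj₂ (canonicalWithin n v (acyclic⇒walkLength<n acyclic))

  detourEdge : Fin n → Fin n → Maybe (Fin n × Fin n)
  detourEdge u w = if does (w ≟ next u) then nothing else just (u , w)

  lastDetour : ∀ {x y} → Walk E x y → Maybe (Fin n × Fin n)
  lastDetour [] = nothing
  lastDetour (_∷_ {x} {y} _ p) = lastDetour p <∣> detourEdge x y

  lastDetour-canonical : ∀ {x y} (p : Walk E x y) → Canonical p → lastDetour p ≡ nothing
  lastDetour-canonical [] _ = refl
  lastDetour-canonical (_∷_ {x} _ p) (refl , canonical-p)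
    rewrite lastDetour-canonical p canonical-p | dec-true (next x ≟ next x) refl = refl

  lastDetour-++ᵂ : ∀ {x y z d} (p : Walk E x y) (q : Walk E y z) →
    lastDetour q ≡ just d → lastDetour (p ++ᵂ q) ≡ just d
  lastDetour-++ᵂ [] q eq = eq
  lastDetour-++ᵂ (_ ∷ p) q eq rewrite lastDetour-++ᵂ p q eq = refl

  Detour : Fin n × Fin n → Set
  Detour (u , w) = Edge E u w × w ≢ next u

  detour? : Decidable Detour
  detour? (u , w) = (E u w Bool.≟ true) ×-dec ¬? (w ≟ next u)

  -- Non-edges are sent to the canonical path; they never occur below.
  detourPath : Fin n × Fin n → Walk E s t
  detourPath (u , w) with E u w Bool.≟ true
  ... | yes e = proj₁ (onPath u) ++ᵂ e ∷ canonical w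
  ... | no _ = canonical s

  lastDetour-detourPath : ∀ d → Detour d → lastDetour (detourPath d) ≡ just d
  lastDetour-detourPath (u , w) (e , w≢next) with E u w Bool.≟ true
  ... | no ¬e = contradiction e ¬e
  ... | yes e = lastDetour-++ᵂ (proj₁ (onPath u)) (e ∷ canonical w) lastDetour-tail
    where
    lastDetour-tail : lastDetour (canonical w) <∣> detourEdge u w ≡ just (u , w)
    lastDetour-tail rewrite lastDetour-canonical (canonical w) (canonical-isCanonical w)
                          | dec-false (w ≟ next u) w≢next = refl

  vertexPairs : List (Fin n × Fin n)
  vertexPairs = cartesianProduct (allFin n) (allFin n)

  detours : List (Fin n × Fin n)
  detours = filter detour? vertexPairs

  encode : Maybe (Fin n × Fin n) → Walk E s t
  encode nothing = canonical s
  encode (just d) = detourPath d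

  codes : List (Maybe (Fin n × Fin n))
  codes = nothing ∷ map just detours

  unique-codes : Unique codes
  unique-codes = All.map⁺ (All.universal (λ _ ()) detours)
               ∷ Unique.map⁺ just-injective (Unique.filter⁺ detour? (Unique.cartesianProduct⁺ (Unique.allFin⁺ n) (Unique.allFin⁺ n)))

  lastDetour-encode : All (λ c → lastDetour (encode c) ≡ c) codes
  lastDetour-encode = lastDetour-canonical (canonical s) (canonical-isCanonical s)
                    ∷ All.map⁺ (All.map (lastDetour-detourPath _) (All.all-filter detour? vertexPairs))

  stPaths : List (Walk E s t)
  stPaths = map encode codes

  unique-stPaths : Unique stPaths
  unique-stPaths = unique-map-leftInverse encode lastDetour lastDetour-encode unique-codes

  length-stPaths : length stPaths ≡ suc (length detours)
  length-stPaths = trans (length-map encode codes) (cong suc (length-map just detours))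

  length-detours : length detours ≡ ∑[ u < n ] ∑[ w < n ] 𝟙 (detour? (u , w))
  length-detours = begin
    length detours
      ≡⟨ length-filter detour? vertexPairs ⟩
    sum (map (𝟙 ∘ detour?) vertexPairs)
      ≡⟨ sum-map-cartesianProduct (𝟙 ∘ detour?) (allFin n) (allFin n) ⟩
    sum (map (λ u → sum (map (λ w → 𝟙 (detour? (u , w))) (allFin n))) (allFin n))
      ≡⟨ sum-map-allFin (λ u → sum (map (λ w → 𝟙 (detour? (u , w))) (allFin n))) ⟩
    ∑[ u < n ] sum (map (λ w → 𝟙 (detour? (u , w))) (allFin n))
      ≡⟨ sum-cong-≗ (λ u → sum-map-allFin (λ w → 𝟙 (detour? (u , w)))) ⟩
    ∑[ u < n ] ∑[ w < n ] 𝟙 (detour? (u , w)) ∎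
    where open ≡-Reasoning

  next-edge-indicator : ∀ u → indicator (E u (next u)) ≡ 𝟙 (¬? (u ≟ t))
  next-edge-indicator u with u ≟ t
  ... | yes refl = cong indicator (outDeg≡0⇒¬edge E outDeg-t (next t))
  ... | no u≢t = cong indicator (next-edge u u≢t)

  outDeg-split : ∀ u → outDeg E u ≡ ∑[ w < n ] 𝟙 (detour? (u , w)) + 𝟙 (¬? (u ≟ t))
  outDeg-split u = begin
    outDeg E u
      ≡⟨ outDeg-∑ E u ⟩
    ∑[ w < n ] indicator (E u w)
      ≡⟨ sum-cong-≗ (λ w → split (E u w) (does (w ≟ next u))) ⟩
    ∑[ w < n ] (𝟙 (detour? (u , w)) + 𝟙 (w ≟ next u) * indicator (E u w))
      ≡⟨ ∑-distrib-+ (λ w → 𝟙 (detour? (u , w))) (λ w → 𝟙 (w ≟ next u) * indicator (E u w)) ⟩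
    ∑[ w < n ] 𝟙 (detour? (u , w)) + ∑[ w < n ] (𝟙 (w ≟ next u) * indicator (E u w))
      ≡⟨ cong (∑[ w < n ] 𝟙 (detour? (u , w)) +_) (trans (∑-δ (next u) (indicator ∘ E u)) (next-edge-indicator u)) ⟩
    ∑[ w < n ] 𝟙 (detour? (u , w)) + 𝟙 (¬? (u ≟ t)) ∎
    where
    open ≡-Reasoning
    split : ∀ a b → indicator a ≡ indicator (does (a Bool.≟ true) ∧ not b) + indicator b * indicator a
    split true true = refl
    split true false = refl
    split false true = refl
    split false false = refl

  length-detours+n : length detours + n ≡ edgeCount E + 1
  length-detours+n = begin
    length detours + n
      ≡⟨ cong₂ _+_ length-detours (sym (∑-𝟙≢ t)) ⟩
    ∑[ u < n ] ∑[ w < n ] 𝟙 (detour? (u , w)) + (∑[ u < n ] 𝟙 (¬? (u ≟ t)) + 1)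
      ≡⟨ +-assoc (∑[ u < n ] ∑[ w < n ] 𝟙 (detour? (u , w))) (∑[ u < n ] 𝟙 (¬? (u ≟ t))) 1 ⟨
    ∑[ u < n ] ∑[ w < n ] 𝟙 (detour? (u , w)) + ∑[ u < n ] 𝟙 (¬? (u ≟ t)) + 1
      ≡⟨ cong (_+ 1) (∑-distrib-+ (λ u → ∑[ w < n ] 𝟙 (detour? (u , w))) (λ u → 𝟙 (¬? (u ≟ t)))) ⟨
    ∑[ u < n ] (∑[ w < n ] 𝟙 (detour? (u , w)) + 𝟙 (¬? (u ≟ t))) + 1
      ≡⟨ cong (_+ 1) (sum-cong-≗ outDeg-split) ⟨
    edgeCount E + 1 ∎
    where open ≡-Reasoning

module DegreeBound {n} (E : Digraph n) (s t : Fin n) (onPath : VerticesOnSTPaths E s t)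
  (deg-s : deg E s ≥ 2) (deg-t : deg E t ≥ 2) (noChain : NoConsecutiveDeg2 E) where

  Deg2 : Pred (Fin n) _
  Deg2 v = deg E v ≡ 2 × v ≢ t

  deg2? : Decidable Deg2
  deg2? v = (deg E v ℕ.≟ 2) ×-dec ¬? (v ≟ t)

  deg2-independent : ∀ u w → Edge E u w → Deg2 u → Deg2 w → ⊥
  deg2-independent u w e (deg-u , _) (deg-w , w≢t) =
    noChain u w _ e (successor-edge (proj₂ (onPath w)) w≢t) deg-u deg-w

  internal-deg≥2 : ∀ {v} → v ≢ s → v ≢ t → deg E v ≥ 2
  internal-deg≥2 {v} v≢s v≢t =
    +-mono-≤ (edge⇒inDeg≥1 E (proj₂ (lastEdge (proj₁ (onPath v)) (v≢s ∘ sym))))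
             (edge⇒outDeg≥1 E (successor-edge (proj₂ (onPath v)) v≢t))

  weight : Fin n → ℕ
  weight v = 2 * deg E v + 𝟙 (deg2? v) * deg E v

  weight≥4 : ∀ {v} → deg E v ≥ 2 → weight v ≥ 4
  weight≥4 deg≥2 = ≤-trans (*-monoʳ-≤ 2 deg≥2) (m≤m+n _ _)

  internal-weight≥6 : ∀ {v} → v ≢ s → v ≢ t → weight v ≥ 6
  internal-weight≥6 {v} v≢s v≢t with deg E v ℕ.≟ 2
  ... | yes deg≡2 = ≤-reflexive (sym (cong₂ (λ d b → 2 * d + indicator b * d) deg≡2 (dec-true (deg2? v) (deg≡2 , v≢t))))
  ... | no deg≢2 = ≤-trans (*-monoʳ-≤ 2 (≤∧≢⇒< (internal-deg≥2 v≢s v≢t) (deg≢2 ∘ sym))) (m≤m+n _ _)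

  corrected-weight≥6 : ∀ v → 𝟙 (v ≟ s) * 2 + 𝟙 (v ≟ t) * 2 + weight v ≥ 6
  corrected-weight≥6 v = by-cases (v ≟ s) (v ≟ t)
    where
    by-cases : (s? : Dec (v ≡ s)) (t? : Dec (v ≡ t)) → 𝟙 s? * 2 + 𝟙 t? * 2 + weight v ≥ 6
    by-cases (yes refl) t? = ≤-trans (+-monoʳ-≤ 2 (weight≥4 deg-s)) (+-monoˡ-≤ (weight v) (m≤m+n 2 (𝟙 t? * 2)))
    by-cases (no _) (yes refl) = +-monoʳ-≤ 2 (weight≥4 deg-t)
    by-cases (no v≢s) (no v≢t) = internal-weight≥6 v≢s v≢t

  ∑-weight : ∑[ v < n ] weight v ≤ 5 * edgeCount E
  ∑-weight = begin
    ∑[ v < n ] weight v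
      ≡⟨ ∑-distrib-+ (λ v → 2 * deg E v) (λ v → 𝟙 (deg2? v) * deg E v) ⟩
    ∑[ v < n ] (2 * deg E v) + ∑[ v < n ] (𝟙 (deg2? v) * deg E v)
      ≡⟨ cong (_+ ∑[ v < n ] (𝟙 (deg2? v) * deg E v)) (trans (sym (*-distribˡ-sum 2 (deg E))) (cong (2 *_) (∑-deg E))) ⟩
    2 * (edgeCount E + edgeCount E) + ∑[ v < n ] (𝟙 (deg2? v) * deg E v)
      ≤⟨ +-monoʳ-≤ _ (independent-∑-deg≤edgeCount E deg2? deg2-independent) ⟩
    2 * (edgeCount E + edgeCount E) + edgeCount E
      ≡⟨ twice-double+once (edgeCount E) ⟩
    5 * edgeCount E ∎
    where
    open ≤-Reasoning
    twice-double+once : ∀ m → 2 * (m + m) + m ≡ 5 * m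
    twice-double+once = solve-∀

  vertices≤edges : 6 * n ≤ 4 + 5 * edgeCount E
  vertices≤edges = begin
    6 * n
      ≡⟨ trans (*-comm 6 n) (sym (∑-const n 6)) ⟩
    ∑[ v < n ] 6
      ≤⟨ ∑-mono-≤ corrected-weight≥6 ⟩
    ∑[ v < n ] (𝟙 (v ≟ s) * 2 + 𝟙 (v ≟ t) * 2 + weight v)
      ≡⟨ ∑-distrib-+ (λ v → 𝟙 (v ≟ s) * 2 + 𝟙 (v ≟ t) * 2) weight ⟩
    ∑[ v < n ] (𝟙 (v ≟ s) * 2 + 𝟙 (v ≟ t) * 2) + ∑[ v < n ] weight v
      ≡⟨ cong (_+ ∑[ v < n ] weight v) (∑-distrib-+ (λ v → 𝟙 (v ≟ s) * 2) (λ v → 𝟙 (v ≟ t) * 2)) ⟩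
    ∑[ v < n ] (𝟙 (v ≟ s) * 2) + ∑[ v < n ] (𝟙 (v ≟ t) * 2) + ∑[ v < n ] weight v
      ≡⟨ cong (_+ ∑[ v < n ] weight v) (cong₂ _+_ (∑-δ s (λ _ → 2)) (∑-δ t (λ _ → 2))) ⟩
    2 + 2 + ∑[ v < n ] weight v
      ≤⟨ +-monoʳ-≤ 4 ∑-weight ⟩
    4 + 5 * edgeCount E ∎
    where open ≤-Reasoning

n≤5*[1+k] : ∀ n m k → 6 * n ≤ 4 + 5 * m → k + n ≡ m + 1 → n ≤ 5 * suc k
n≤5*[1+k] n m k 6n≤4+5m k+n≡m+1 =
  ≤-trans (n≤1+n n) (≤-trans (+-cancelˡ-≤ (5 * n) (1 + n) (5 * k) key) (*-monoʳ-≤ 5 (n≤1+n k)))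
  where
  open ≤-Reasoning
  key : 5 * n + (1 + n) ≤ 5 * n + 5 * k
  key = begin
    5 * n + (1 + n)  ≡⟨ +-comm (5 * n) (1 + n) ⟩
    1 + 6 * n        ≤⟨ +-monoʳ-≤ 1 6n≤4+5m ⟩
    5 + 5 * m        ≡⟨ trans (*-distribˡ-+ 5 m 1) (+-comm (5 * m) 5) ⟨
    5 * (m + 1)      ≡⟨ cong (5 *_) k+n≡m+1 ⟨
    5 * (k + n)      ≡⟨ trans (*-distribˡ-+ 5 k n) (+-comm (5 * k) (5 * n)) ⟩
    5 * n + 5 * k    ∎

lemma15 : (n : ℕ) → n ≥ 2 → (E : Digraph n) → (s t : Fin n)
    → Acyclic E
    → inDeg E s ≡ 0 → outDeg E t ≡ 0
    → VerticesOnSTPaths E s t → EdgesOnSTPaths E s t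
    → deg E s ≥ 2 → deg E t ≥ 2
    → NoConsecutiveDeg2 E
    → Σ (List (Walk E s t)) (λ ps → Unique ps × n ≤ 5 * length ps)
lemma15 n _ E s t acyclic _ outDeg-t onPath _ deg-s deg-t noChain =
  stPaths , unique-stPaths ,
  subst (λ k → n ≤ 5 * k) (sym length-stPaths)
        (n≤5*[1+k] n (edgeCount E) (length detours) vertices≤edges length-detours+n)
  where
  open Detours E acyclic s t onPath outDeg-t
  open DegreeBound E s t onPath deg-s deg-t noChain
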